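{- Let $m,n\ge 2$ be integers and $H=H_{1\times m\times n}$. Let $x=d_{0,0}$ and $y=d_{m,n}$. For every perfect matching $P=P(h_1,\dots,h_m)$ of $H$: $x\in P$ if and only if $(h_1,\dots,h_m)\neq(0,\dots,0)$, and $y\in P$ if and only if $(h_1,\dots,h_m)\neq(n,\dots,n)$.
   Context: For integers $m,n\ge 1$, $H_{1\times m\times n}$ is the planar graph formed by hexagonal cells $T_{i,j}$ ($1\le i\le m$, $1\le j\le n$) of the hexagonal lattice arranged as a parallelogram: each hexagon has a horizontal top and bottom edge; $T_{i,j+1}$ lies directly above $T_{i,j}$ sharing the top edge of $T_{i,j}$; $T_{i+1,j}$ shares the lower-right edge of $T_{i,j}$; $T_{i+1,j+1}$ shares the upper-right edge of $T_{i,j}$. Edges are labeled so that in cell $T_{i,j}$ the top edge is $a_{i,j}$, the bottom edge is $a_{i,j-1}$, the upper-left edge is $b_{i-1,j}$, the lower-right edge is $b_{i,j}$, the upper-right edge is $d_{i,j}$ and the lower-left edge is $d_{i-1,j-1}$ (so $a_{i,j}$ exists for $1\le i\le m,0\le j\le n$; $b_{i,j}$ for $0\le i\le m,1\le j\le n$; $d_{i,j}$ for $0\le i\le m,0\le j\le n$ except $d_{0,n}$ and $d_{m,0}$). Perfect matchings of $H$ correspond bijectively to sequences of integers $n\ge h_1\ge\cdots\ge h_m\ge 0$ (plane partitions): setting $h_0=n$ and $h_{m+1}=0$, the matching $P(h_1,\dots,h_m)$ consists of the edges $a_{i,j}$ with $j=h_i$, the edges $b_{i,j}$ with $h_i\ge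 j>h_{i+1}$, and the edges $d_{i,j}$ with $j>h_i$ or $j<h_{i+1}$. -}

module Defs where

open import Data.Nat using (ℕ; zero; suc; _+_; _≤_; _<_)
open import Data.Vec using (Vec; []; _∷_)
open import Data.Product using (_×_)
open import Data.Sum using (_⊎_)
open import Relation.Nullary using (¬_)
open import Relation.Binary.PropositionalEquality using (_≡_)

data Edge : Set where
  a : ℕ → ℕ → Edge
  b : ℕ → ℕ → Edge
  d : ℕ → ℕ → Edge

ValidEdge : ℕ → ℕ → Edge → Set
ValidEdge m n (a i j) = (1 ≤ i × i ≤ m) × j ≤ n
ValidEdge m n (b i j) = i ≤ m × (1 ≤ j × j ≤ n)
ValidEdge m n (d i j) = (i ≤ m × j ≤ n) × (¬ (i ≡ 0 × j ≡ n) × ¬ (i ≡ m × j ≡ 0))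

-- (h_1,…,h_m) stored as a vector; at h k = h_{k+1}, and 0 out of range.
at : ∀ {m} → Vec ℕ m → ℕ → ℕ
at [] k = 0
at (x ∷ xs) zero = x
at (x ∷ xs) (suc k) = at xs k

-- Extended heights: ext n h 0 = h_0 = n, ext n h i = h_i (1 ≤ i ≤ m), h_{m+1} = 0.
ext : ∀ {m} → ℕ → Vec ℕ m → ℕ → ℕ
ext n h zero = n
ext n h (suc k) = at h k

-- n ≥ h_1 ≥ ⋯ ≥ h_m ≥ 0 (beyond index m+1 all values are 0, so this is harmless).
IsPlanePartition : ∀ {m} → ℕ → Vec ℕ m → Set
IsPlanePartition n h = ∀ i → ext n h (suc i) ≤ ext n h i

InP : (m n : ℕ) → Vec ℕ m → Edge → Set
InP m n h (a i j) = ValidEdge m n (a i j) × j ≡ ext n h i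
InP m n h (b i j) = ValidEdge m n (b i j) × (j ≤ ext n h i × ext n h (suc i) < j)
InP m n h (d i j) = ValidEdge m n (d i j) × (ext n h i < j ⊎ j < ext n h (suc i))

-- Reading the matching rule at the two corners, d₀₀ ∈ P iff h₀ < 0 or 0 < h₁, and dₘₙ ∈ P
-- iff hₘ < n or n < hₘ₊₁; with h₀ = n and hₘ₊₁ = 0 one alternative is impossible each time.
-- Since n ≥ h₁ ≥ ⋯ ≥ hₘ ≥ 0, the partition is all zeros iff h₁ = 0, and all n's iff hₘ = n.
module Submission where

open import Defs
open import Data.Nat using (ℕ; zero; suc; _≤_; _<_; z≤n; s≤s)
open import Data.Nat.Properties using (≤-trans; ≤-reflexive; ≤-refl; ≤-antisym; ≤∧≢⇒<; <⇒≢; n≢0⇒n>0)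
open import Data.Vec using (Vec; replicate; head; []; _∷_)
open import Data.Product using (_×_; _,_)
open import Data.Sum using (inj₁; inj₂)
open import Relation.Nullary using (¬_; contradiction)
open import Relation.Binary.PropositionalEquality using (_≡_; refl; cong; cong₂; subst; sym)
open import Function.Base using (_∘_)
open import Function.Bundles using (_⇔_; mk⇔)
open import Function.Construct.Composition using (_⇔-∘_)
open import Function.Construct.Symmetry using (⇔-sym)

Antitone : ∀ {m} → Vec ℕ m → Set
Antitone h = ∀ i → at h (suc i) ≤ at h i

at-length≡0 : ∀ {m} (h : Vec ℕ m) → at h m ≡ 0
at-length≡0 []       = refl
at-length≡0 (_ ∷ h) = at-length≡0 h

at-replicate : ∀ m v i → i < m → at (replicate m v) i ≡ v
at-replicate (suc m) v zero    _         = refl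
at-replicate (suc m) v (suc i) (s≤s i<m) = at-replicate m v i i<m

antitone-≤-head : ∀ {m} (h : Vec ℕ m) → Antitone h → ∀ i → at h i ≤ at h 0
antitone-≤-head h anti zero    = ≤-refl
antitone-≤-head h anti (suc i) = ≤-trans (anti i) (antitone-≤-head h anti i)

antitone-squeeze : ∀ {k v} (h : Vec ℕ (suc k)) → Antitone h →
                   at h 0 ≤ v → v ≤ at h k → h ≡ replicate (suc k) v
antitone-squeeze         (x ∷ [])     _    x≤v v≤x    = cong (_∷ []) (≤-antisym x≤v v≤x)
antitone-squeeze {v = v} (x ∷ y ∷ ys) anti x≤v v≤last = cong₂ _∷_ x≡v tail≡
  where
  tail≡ : y ∷ ys ≡ replicate _ v
  tail≡ = antitone-squeeze (y ∷ ys) (anti ∘ suc) (≤-trans (anti 0) x≤v) v≤last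
  x≡v : x ≡ v
  x≡v = ≤-antisym x≤v (subst (_≤ x) (cong head tail≡) (anti 0))

≢replicate-0⇔head>0 : ∀ {k} (h : Vec ℕ (suc k)) → Antitone h →
                      (¬ h ≡ replicate (suc k) 0) ⇔ 0 < at h 0
≢replicate-0⇔head>0 h anti = mk⇔
  (λ h≢0 → n≢0⇒n>0 (h≢0 ∘ λ head≡0 → antitone-squeeze h anti (≤-reflexive head≡0) z≤n))
  (λ { head>0 refl → <⇒≢ head>0 refl })

≢replicate⇔last< : ∀ {k v} (h : Vec ℕ (suc k)) → Antitone h → at h 0 ≤ v →
                   (¬ h ≡ replicate (suc k) v) ⇔ at h k < v
≢replicate⇔last< {k} {v} h anti head≤v = mk⇔
  (λ h≢v → ≤∧≢⇒< (≤-trans (antitone-≤-head h anti k) head≤v)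
                   (h≢v ∘ antitone-squeeze h anti head≤v ∘ ≤-reflexive ∘ sym))
  (λ { last<v refl → <⇒≢ last<v (at-replicate (suc k) v k ≤-refl) })

d₀₀∈P⇔head>0 : ∀ {k n} (h : Vec ℕ (suc k)) → InP (suc k) (suc n) h (d 0 0) ⇔ 0 < at h 0
d₀₀∈P⇔head>0 h = mk⇔
  (λ { (_ , inj₁ ()) ; (_ , inj₂ head>0) → head>0 })
  (λ head>0 → (((z≤n , z≤n) , (λ { (_ , ()) }) , (λ { (() , _) })) , inj₂ head>0))

dₘₙ∈P⇔last< : ∀ {k n} (h : Vec ℕ (suc k)) →
              InP (suc k) (suc n) h (d (suc k) (suc n)) ⇔ at h k < suc n
dₘₙ∈P⇔last< {n = n} h = mk⇔
  (λ { (_ , inj₁ last<n) → last<n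
     ; (_ , inj₂ n<hₘ₊₁) → contradiction (subst (suc n <_) (at-length≡0 h) n<hₘ₊₁) λ () })
  (λ last<n → (((≤-refl , ≤-refl) , (λ { (() , _) }) , (λ { (_ , ()) })) , inj₁ last<n))

lemma3p8 : (m n : ℕ) → 2 ≤ m → 2 ≤ n → (h : Vec ℕ m) → IsPlanePartition n h →
    (InP m n h (d 0 0) ⇔ (¬ (h ≡ replicate m 0)))
    × (InP m n h (d m n) ⇔ (¬ (h ≡ replicate m n)))
lemma3p8 (suc k) (suc n) (s≤s _) (s≤s _) h pp =
    ⇔-sym (≢replicate-0⇔head>0 h anti) ⇔-∘ d₀₀∈P⇔head>0 h
  , ⇔-sym (≢replicate⇔last< h anti (pp 0)) ⇔-∘ dₘₙ∈P⇔last< h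
  where
  anti : Antitone h
  anti = pp ∘ suc
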